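{- Let $K$ be an imaginary quadratic field and $D$ given. If some circle of $\mathcal{S}_D$ contains a point of $\widehat{K}=K\cup\{\infty\}$, then $H(D,\Delta)=1$; and if $H(D,\Delta)=1$, then every circle of $\mathcal{S}_D$ contains a point of $\widehat{K}$.
   Context: $K$ is an imaginary quadratic field with ring of integers $\mathcal{O}$ and discriminant $\Delta<0$; $\sqrt{\Delta}=i\sqrt{|\Delta|}$. $H(a,b)=1$ if $ax^2+by^2=z^2$ has a nonzero rational solution $(x,y,z)$ and $H(a,b)=-1$ otherwise. An oriented circle $C$ is determined by $\zeta\in\mathbb{C}$, $r,\hat r\in\mathbb{R}$ with $|\zeta|^2-r\hat r=1$; as a point set $C=\{\alpha/\beta\in\widehat{\mathbb{C}}: r|\alpha|^2-2\Re(\overline{\alpha}\beta\zeta)+\hat r|\beta|^2=0\}$; $\mathbf{v}_C=[\zeta\;\overline{\zeta}\;\hat r\;r]$. $\mathcal{S}_D$ is the set of oriented circles with $i\sqrt{D}\,\mathbf{v}_C\in\mathcal{O}^2\times\sqrt{\Delta}\mathbb{Z}^2$. -}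

module Defs where

open import Data.Nat as ℕ using (ℕ)
open import Data.Nat.Divisibility as ℕD using ()
open import Data.Integer as ℤ using (ℤ; +_; ∣_∣)
open import Data.Rational as ℚ using (ℚ; 0ℚ; _/_)
open import Data.Product using (Σ; ∃; ∃-syntax; _×_; _,_)
open import Data.Sum using (_⊎_)
open import Relation.Binary.PropositionalEquality using (_≡_)
open import Relation.Nullary using (¬_)

SquareFree : ℤ → Set
SquareFree n = ∀ (d : ℕ) → (d ℕ.* d) ℕD.∣ ∣ n ∣ → d ≡ 1

IsFundamentalDiscriminant : ℤ → Set
IsFundamentalDiscriminant Δ =
    (SquareFree Δ × ∃[ k ] Δ ≡ + 1 ℤ.+ + 4 ℤ.* k)
  ⊎ (∃[ m ] (Δ ≡ + 4 ℤ.* m × SquareFree m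
             × ((∃[ k ] m ≡ + 2 ℤ.+ + 4 ℤ.* k) ⊎ (∃[ k ] m ≡ + 3 ℤ.+ + 4 ℤ.* k))))

record ImagQuadField : Set where
  field
    Δ     : ℤ
    Δ<0   : Δ ℤ.< + 0
    fund  : IsFundamentalDiscriminant Δ

module Field (F : ImagQuadField) where
  open ImagQuadField F public

  Δℚ : ℚ
  Δℚ = Δ / 1

  record K : Set where
    constructor _+_√Δ
    field
      re : ℚ
      im : ℚ
  open K public

  zeroK : K
  zeroK = 0ℚ + 0ℚ √Δ

  _·_ : K → K → K
  (a + b √Δ) · (c + d √Δ) = (a ℚ.* c ℚ.+ b ℚ.* d ℚ.* Δℚ) + (a ℚ.* d ℚ.+ b ℚ.* c) √Δ

  conj : K → K
  conj (a + b √Δ) = a + (ℚ.- b) √Δ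

  negK : K → K
  negK (a + b √Δ) = (ℚ.- a) + (ℚ.- b) √Δ

  N : K → ℚ
  N (a + b √Δ) = a ℚ.* a ℚ.- Δℚ ℚ.* b ℚ.* b

  ω : K
  ω = (Δ / 2) + (+ 1 / 2) √Δ

  _∈𝒪 : K → Set
  x ∈𝒪 = ∃[ u ] ∃[ v ] x ≡ ((u / 1) + 0ℚ √Δ) ⊕ ((v / 1) ⊙ ω)
    where
      _⊕_ : K → K → K
      (a + b √Δ) ⊕ (c + d √Δ) = (a ℚ.+ c) + (b ℚ.+ d) √Δ
      _⊙_ : ℚ → K → K
      q ⊙ (a + b √Δ) = (q ℚ.* a) + (q ℚ.* b) √Δ

  -- Oriented circles of 𝒮_D, via their scaled vector  i√D·v_C.
  -- For C = (ζ, r, r̂) in 𝒮_D write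
  --   i√D·ζ = z ∈ 𝒪,  i√D·ζ̄ = z' ∈ 𝒪,  i√D·r̂ = m√Δ,  i√D·r = n√Δ  (m,n ∈ ℤ).
  -- Since ζ̄ is the conjugate of ζ, z' = -conj(z); the relation
  -- |ζ|² - r r̂ = 1 becomes N(z) + m n Δ = D.  Conversely every such
  -- tuple determines a unique oriented circle of 𝒮_D.
  record CircleSD (D : ℕ) : Set where
    field
      z   : K
      z'  : K
      m   : ℤ
      n   : ℤ
      z∈𝒪   : z ∈𝒪
      z'∈𝒪  : z' ∈𝒪
      z'-is-conj : z' ≡ negK (conj z)
      circle : N z ℚ.+ (m / 1) ℚ.* (n / 1) ℚ.* Δℚ ≡ (+ D) / 1

  -- The point α/β (α, β ∈ K, not both 0) lies on C:
  --   r|α|² - 2Re(ᾱ β ζ) + r̂|β|² = 0.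
  -- Dividing by the positive real √(|Δ|/D) this is
  --   n N(α) - 2·Re(ᾱβz/√Δ) + m N(β) = 0, and Re(w/√Δ) = im(w) for w ∈ K.
  OnCircle : {D : ℕ} → CircleSD D → K → K → Set
  OnCircle C α β =
    (CircleSD.n C / 1) ℚ.* N α
      ℚ.- (+ 2 / 1) ℚ.* im (conj α · (β · CircleSD.z C))
      ℚ.+ (CircleSD.m C / 1) ℚ.* N β
    ≡ 0ℚ

  -- C contains a point of K̂ = K ∪ {∞}  (β = 0 gives ∞)
  ContainsKPoint : {D : ℕ} → CircleSD D → Set
  ContainsKPoint C =
    ∃[ α ] ∃[ β ] (¬ (α ≡ zeroK × β ≡ zeroK) × OnCircle C α β)

H≡1 : ℚ → ℚ → Set
H≡1 a b = ∃[ x ] ∃[ y ] ∃[ z ]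
  (¬ (x ≡ 0ℚ × y ≡ 0ℚ × z ≡ 0ℚ) × a ℚ.* x ℚ.* x ℚ.+ b ℚ.* y ℚ.* y ≡ z ℚ.* z)

{-# OPTIONS --safe #-}
module Submission where

open import Defs
open import Data.Nat using (ℕ; NonZero)
open import Data.Integer using (+_)
open import Data.Rational using (_/_)
open import Data.Product using (_×_; ∃-syntax)

open import Data.Integer as ℤ using (-[1+_]; +<+)
open import Data.Nat using (suc)
open import Data.Product using (_,_; proj₁; proj₂)
open import Data.Rational as ℚ using (ℚ; 0ℚ; 1ℚ; _+_; _*_; _-_; -_; 1/_; _≤_; _≥_; Negative)
import Data.Rational.Properties as ℚP
open import Algebra.Properties.Group ℚP.+-0-group using (x∙y⁻¹≈ε⇒x≈y; x≈y⇒x∙y⁻¹≈ε)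
open import Data.Sum using (inj₁; inj₂)
open import Function using (_∘_; _⇔_; mk⇔; Equivalence)
open import Level using (0ℓ)
open import Relation.Binary.PropositionalEquality
open import Relation.Nullary using (yes; no)
open import Relation.Nullary.Decidable using (dec⇒maybe)
open import Tactic.RingSolver using (solve-∀)
open import Tactic.RingSolver.Core.AlmostCommutativeRing using (AlmostCommutativeRing; fromCommutativeRing)

-- A circle C of 𝒮_D with r ≠ 0 has centre ζ/r and radius 1/|r|.  In the scaled coordinates
-- i√D·ζ = z, i√D·r = n√Δ, completing the square shows that α/β lies on C iff
-- N(n√Δ·α − zβ) = D·N(β).  As N is multiplicative and positive definite, a K-point on C
-- therefore makes D a norm from K, and conversely D·x² = N(w) yields the K-point
-- α/β = √Δ(w + xz)/(nΔx).  Lines (r = 0) pass through ∞ and satisfy D = N(z) directly.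
-- Finally, D is a norm from K exactly when Dx² + Δy² = z² has a solution with x ≠ 0, and a
-- nontrivial solution with x = 0 is impossible as N is definite; so this is H(D, Δ) = 1.

ℚ-ring : AlmostCommutativeRing 0ℓ 0ℓ
ℚ-ring = fromCommutativeRing ℚP.+-*-commutativeRing (λ p → dec⇒maybe (0ℚ ℚP.≟ p))

p*q≡0⇒q≡0 : ∀ {p q} → p ≢ 0ℚ → p * q ≡ 0ℚ → q ≡ 0ℚ
p*q≡0⇒q≡0 {p} {q} p≢0 pq≡0 = begin
  q              ≡⟨ sym (ℚP.*-identityˡ q) ⟩
  1ℚ * q         ≡⟨ cong (_* q) (sym (ℚP.*-inverseˡ p)) ⟩
  1/ p * p * q   ≡⟨ ℚP.*-assoc (1/ p) p q ⟩
  1/ p * (p * q) ≡⟨ cong (1/ p *_) pq≡0 ⟩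
  1/ p * 0ℚ      ≡⟨ ℚP.*-zeroʳ (1/ p) ⟩
  0ℚ             ∎
  where
  open ≡-Reasoning
  instance _ = ℚ.≢-nonZero p≢0

p≢0∧q≢0⇒p*q≢0 : ∀ {p q} → p ≢ 0ℚ → q ≢ 0ℚ → p * q ≢ 0ℚ
p≢0∧q≢0⇒p*q≢0 p≢0 q≢0 = q≢0 ∘ p*q≡0⇒q≡0 p≢0

p*p≡0⇒p≡0 : ∀ {p} → p * p ≡ 0ℚ → p ≡ 0ℚ
p*p≡0⇒p≡0 {p} pp≡0 with p ℚP.≟ 0ℚ
... | yes p≡0 = p≡0
... | no  p≢0 = p*q≡0⇒q≡0 p≢0 pp≡0

p*p≥0 : ∀ p → p * p ≥ 0ℚ
p*p≥0 p with ℚP.≤-total 0ℚ p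
... | inj₁ 0≤p = let instance _ = ℚ.nonNegative 0≤p in
  ℚP.nonNegative⁻¹ _ {{ℚP.nonNeg*nonNeg⇒nonNeg p p}}
... | inj₂ p≤0 = let instance _ = ℚ.nonPositive p≤0 in
  ℚP.nonNegative⁻¹ _ {{ℚP.nonPos*nonPos⇒nonPos p p}}

p≡r-q⇒p+q≡r : ∀ {p q r} → p ≡ r - q → p + q ≡ r
p≡r-q⇒p+q≡r {q = q} {r} refl = r-q+q≡r q r
  where
  r-q+q≡r : ∀ q r → r - q + q ≡ r
  r-q+q≡r = solve-∀ ℚ-ring

p+q≡r⇒p≡r-q : ∀ {p q r} → p + q ≡ r → p ≡ r - q
p+q≡r⇒p≡r-q {p} {q} refl = p≡p+q-q p q
  where
  p≡p+q-q : ∀ p q → p ≡ p + q - q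
  p≡p+q-q = solve-∀ ℚ-ring

i<0⇒i/1-negative : ∀ {i} → i ℤ.< + 0 → Negative (i / 1)
i<0⇒i/1-negative {+ _}      (+<+ ())
i<0⇒i/1-negative { -[1+ k ]} _ = ℚP.neg-pos {ℚ.normalize (suc k) 1} (ℚP.normalize-pos (suc k) 1)

module _ (F : ImagQuadField) where
  open Field F

  Δℚ-negative : Negative Δℚ
  Δℚ-negative = i<0⇒i/1-negative Δ<0

  Δℚ≢0 : Δℚ ≢ 0ℚ
  Δℚ≢0 = ℚP.<⇒≢ (ℚP.negative⁻¹ Δℚ {{Δℚ-negative}})

  ι : ℚ → K
  ι q = q + 0ℚ √Δ

  infixl 6 _-ᴷ_
  _-ᴷ_ : K → K → K
  (a + b √Δ) -ᴷ (c + d √Δ) = (a - c) + (b - d) √Δ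

  N-ι : ∀ q → N (ι q) ≡ q * q
  N-ι q = identity q Δℚ
    where
    identity : ∀ q e → q * q - e * 0ℚ * 0ℚ ≡ q * q
    identity = solve-∀ ℚ-ring

  N-conj : ∀ x → N (conj x) ≡ N x
  N-conj x = identity (re x) (im x) Δℚ
    where
    identity : ∀ a b e → a * a - e * (- b) * (- b) ≡ a * a - e * b * b
    identity = solve-∀ ℚ-ring

  N-· : ∀ x y → N (x · y) ≡ N x * N y
  N-· x y = identity (re x) (im x) (re y) (im y) Δℚ
    where
    identity : ∀ a b c d e →
      (a * c + b * d * e) * (a * c + b * d * e) - e * (a * d + b * c) * (a * d + b * c)
      ≡ (a * a - e * b * b) * (c * c - e * d * d)
    identity = solve-∀ ℚ-ring

  N≡0⇒≡zeroK : ∀ x → N x ≡ 0ℚ → x ≡ zeroK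
  N≡0⇒≡zeroK (a + b √Δ) Nx≡0 = cong₂ _+_√Δ (p*p≡0⇒p≡0 a²≡0) (p*p≡0⇒p≡0 b²≡0)
    where
    instance
      _ = ℚP.neg⇒nonPos Δℚ {{Δℚ-negative}}
      _ = ℚ.nonNegative (p*p≥0 b)
    a²≡Δb² : a * a ≡ Δℚ * b * b
    a²≡Δb² = x∙y⁻¹≈ε⇒x≈y _ _ Nx≡0
    Δb²≤0 : Δℚ * b * b ≤ 0ℚ
    Δb²≤0 = subst (_≤ 0ℚ) (sym (ℚP.*-assoc Δℚ b b))
                  (ℚP.nonPositive⁻¹ _ {{ℚP.nonPos*nonNeg⇒nonPos Δℚ (b * b)}})
    a²≡0 : a * a ≡ 0ℚ
    a²≡0 = ℚP.≤-antisym (ℚP.≤-trans (ℚP.≤-reflexive a²≡Δb²) Δb²≤0) (p*p≥0 a)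
    b²≡0 : b * b ≡ 0ℚ
    b²≡0 = p*q≡0⇒q≡0 Δℚ≢0 (trans (sym (ℚP.*-assoc Δℚ b b)) (trans (sym a²≡Δb²) a²≡0))

  -- q = N(w/x), stated without division.
  IsNorm : ℚ → Set
  IsNorm q = ∃[ x ] ∃[ w ] (x ≢ 0ℚ × q * x * x ≡ N w)

  IsNorm⇒H≡1 : ∀ {q} → IsNorm q → H≡1 q Δℚ
  IsNorm⇒H≡1 (x , w , x≢0 , qxx≡Nw) = x , im w , re w , x≢0 ∘ proj₁ , p≡r-q⇒p+q≡r qxx≡Nw

  H≡1⇒IsNorm : ∀ {q} → H≡1 q Δℚ → IsNorm q
  H≡1⇒IsNorm {q} (x , y , z , nontrivial , eq) = x , z + y √Δ , x≢0 , qxx≡N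
    where
    qxx≡N : q * x * x ≡ N (z + y √Δ)
    qxx≡N = p+q≡r⇒p≡r-q eq
    x≢0 : x ≢ 0ℚ
    x≢0 x≡0 = nontrivial (x≡0 , cong im w≡0 , cong re w≡0)
      where
      qxx≡0 : q * x * x ≡ 0ℚ
      qxx≡0 = trans (cong (λ t → q * t * t) x≡0) (ℚP.*-zeroʳ (q * 0ℚ))
      w≡0 : z + y √Δ ≡ zeroK
      w≡0 = N≡0⇒≡zeroK (z + y √Δ) (trans (sym qxx≡N) qxx≡0)

  norm-ratio⇒IsNorm : ∀ {q} β γ → N β ≢ 0ℚ → q * N β ≡ N γ → IsNorm q
  norm-ratio⇒IsNorm {q} β γ Nβ≢0 qNβ≡Nγ = N β , γ · conj β , Nβ≢0 , (begin
    q * N β * N β       ≡⟨ cong (_* N β) qNβ≡Nγ ⟩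
    N γ * N β           ≡⟨ cong (N γ *_) (sym (N-conj β)) ⟩
    N γ * N (conj β)    ≡⟨ sym (N-· γ (conj β)) ⟩
    N (γ · conj β)      ∎)
    where open ≡-Reasoning

  module _ {D : ℕ} (C : CircleSD D) where
    open CircleSD C

    circleForm : K → K → ℚ
    circleForm α β = n / 1 * N α - + 2 / 1 * im (conj α · (β · z)) + m / 1 * N β

    -- n√Δ·(α − cβ), where c = ζ/r = z/(n√Δ) is the centre of C.
    fromCentre : K → K → K
    fromCentre α β = (0ℚ + (n / 1) √Δ) · α -ᴷ z · β

    circleForm-completeSquare : ∀ α β →
      n / 1 * Δℚ * circleForm α β ≡ + D / 1 * N β - N (fromCentre α β)
    circleForm-completeSquare α β = trans
      (identity (re z) (im z) (m / 1) (n / 1) Δℚ (re α) (im α) (re β) (im β))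
      (cong (λ d → d * N β - N (fromCentre α β)) circle)
      where
      identity : ∀ a b m n e x₁ x₂ y₁ y₂ →
        let norm : ℚ → ℚ → ℚ
            norm u v = u * u - e * v * v
        in n * e * (n * norm x₁ x₂ - + 2 / 1 * (x₁ * (y₁ * b + y₂ * a) + (- x₂) * (y₁ * a + y₂ * b * e))
                    + m * norm y₁ y₂)
           ≡ (norm a b + m * n * e) * norm y₁ y₂
             - norm (0ℚ * x₁ + n * x₂ * e - (a * y₁ + b * y₂ * e)) (0ℚ * x₂ + n * x₁ - (a * y₂ + b * y₁))
      identity = solve-∀ ℚ-ring

    circleForm-∞ : ∀ α → circleForm α zeroK ≡ n / 1 * N α
    circleForm-∞ α = identity (re z) (im z) (m / 1) (n / 1) Δℚ (re α) (im α)
      where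
      identity : ∀ a b m n e x₁ x₂ →
        n * (x₁ * x₁ - e * x₂ * x₂)
          - + 2 / 1 * (x₁ * (0ℚ * b + 0ℚ * a) + (- x₂) * (0ℚ * a + 0ℚ * b * e))
          + m * (0ℚ * 0ℚ - e * 0ℚ * 0ℚ)
        ≡ n * (x₁ * x₁ - e * x₂ * x₂)
      identity = solve-∀ ℚ-ring

    onCircle⇔ : n / 1 ≢ 0ℚ → ∀ α β → OnCircle C α β ⇔ + D / 1 * N β ≡ N (fromCentre α β)
    onCircle⇔ n≢0 α β = mk⇔
      (λ onC → x∙y⁻¹≈ε⇒x≈y _ _ (trans (sym (circleForm-completeSquare α β))
                                       (trans (cong (n / 1 * Δℚ *_) onC) (ℚP.*-zeroʳ (n / 1 * Δℚ)))))
      (λ normEq → p*q≡0⇒q≡0 (p≢0∧q≢0⇒p*q≢0 n≢0 Δℚ≢0)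
                    (trans (circleForm-completeSquare α β) (x≈y⇒x∙y⁻¹≈ε normEq)))

    line⇒IsNorm : n / 1 ≡ 0ℚ → IsNorm (+ D / 1)
    line⇒IsNorm n≡0 = 1ℚ , z , ℚP.1≢0 , (begin
      + D / 1 * 1ℚ * 1ℚ             ≡⟨ trans (ℚP.*-identityʳ _) (ℚP.*-identityʳ _) ⟩
      + D / 1                       ≡⟨ sym circle ⟩
      N z + m / 1 * (n / 1) * Δℚ    ≡⟨ cong (λ t → N z + m / 1 * t * Δℚ) n≡0 ⟩
      N z + m / 1 * 0ℚ * Δℚ         ≡⟨ identity (N z) (m / 1) Δℚ ⟩
      N z                           ∎)
      where
      open ≡-Reasoning
      identity : ∀ a m e → a + m * 0ℚ * e ≡ a
      identity = solve-∀ ℚ-ring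

    containsKPoint⇒IsNorm : ContainsKPoint C → IsNorm (+ D / 1)
    containsKPoint⇒IsNorm (α , β , nonzero , onC) with n / 1 ℚP.≟ 0ℚ
    ... | yes n≡0 = line⇒IsNorm n≡0
    ... | no  n≢0 =
      norm-ratio⇒IsNorm {+ D / 1} β (fromCentre α β) Nβ≢0 (Equivalence.to (onCircle⇔ n≢0 α β) onC)
      where
      Nβ≢0 : N β ≢ 0ℚ
      Nβ≢0 Nβ≡0 = nonzero (α≡0 , β≡0)
        where
        β≡0 : β ≡ zeroK
        β≡0 = N≡0⇒≡zeroK β Nβ≡0
        α≡0 : α ≡ zeroK
        α≡0 = N≡0⇒≡zeroK α
                (p*q≡0⇒q≡0 n≢0 (trans (sym (circleForm-∞ α)) (subst (OnCircle C α) β≡0 onC)))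

    IsNorm⇒containsKPoint : IsNorm (+ D / 1) → ContainsKPoint C
    IsNorm⇒containsKPoint (x , w , x≢0 , Dxx≡Nw) with n / 1 ℚP.≟ 0ℚ
    ... | yes n≡0 = ι 1ℚ , zeroK , ℚP.1≢0 ∘ cong re ∘ proj₁ ,
                    trans (circleForm-∞ (ι 1ℚ)) (trans (cong (_* N (ι 1ℚ)) n≡0) (ℚP.*-zeroˡ (N (ι 1ℚ))))
    ... | no  n≢0 = α , β , cx≢0 ∘ cong re ∘ proj₂ , Equivalence.from (onCircle⇔ n≢0 α β) normEq
      where
      c : ℚ
      c = n / 1 * Δℚ
      -- α/β = √Δ(w + xz)/(nΔx), for which fromCentre α β = nΔ·w.
      α β : K
      α = (Δℚ * (im w + x * im z)) + (re w + x * re z) √Δ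
      β = ι (c * x)
      cx≢0 : c * x ≢ 0ℚ
      cx≢0 = p≢0∧q≢0⇒p*q≢0 (p≢0∧q≢0⇒p*q≢0 n≢0 Δℚ≢0) x≢0
      N-fromCentre : N (fromCentre α β) ≡ c * c * N w
      N-fromCentre = identity (re z) (im z) (n / 1) Δℚ x (re w) (im w)
        where
        identity : ∀ a b n e x w₁ w₂ →
          let g₁ = 0ℚ * (e * (w₂ + x * b)) + n * (w₁ + x * a) * e - (a * (n * e * x) + b * 0ℚ * e)
              g₂ = 0ℚ * (w₁ + x * a) + n * (e * (w₂ + x * b)) - (a * 0ℚ + b * (n * e * x))
          in g₁ * g₁ - e * g₂ * g₂ ≡ n * e * (n * e) * (w₁ * w₁ - e * w₂ * w₂)
        identity = solve-∀ ℚ-ring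
      normEq : + D / 1 * N β ≡ N (fromCentre α β)
      normEq = begin
        + D / 1 * N β              ≡⟨ cong (+ D / 1 *_) (N-ι (c * x)) ⟩
        + D / 1 * (c * x * (c * x)) ≡⟨ identity (+ D / 1) c x ⟩
        c * c * (+ D / 1 * x * x)   ≡⟨ cong (c * c *_) Dxx≡Nw ⟩
        c * c * N w                ≡⟨ sym N-fromCentre ⟩
        N (fromCentre α β)         ∎
        where
        open ≡-Reasoning
        identity : ∀ d c x → d * (c * x * (c * x)) ≡ c * c * (d * x * x)
        identity = solve-∀ ℚ-ring

lemma3p7 : (F : ImagQuadField) (D : ℕ) → .{{_ : NonZero D}} →
    let open Field F in
    ((∃[ C ] ContainsKPoint {D} C) → H≡1 ((+ D) / 1) (ImagQuadField.Δ F / 1))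
    × (H≡1 ((+ D) / 1) (ImagQuadField.Δ F / 1) → (C : CircleSD D) → ContainsKPoint C)
lemma3p7 F D =
  (λ (C , p) → IsNorm⇒H≡1 F {+ D / 1} (containsKPoint⇒IsNorm F C p)) ,
  (λ H C → IsNorm⇒containsKPoint F C (H≡1⇒IsNorm F {+ D / 1} H))
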